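{- Let $c\ge 1$ be an integer and let $H$ be a graph with ${\sf td}(H)\le c$. Let $R'$ be the vertex set of a connected component of $H$ and let $Y' \subseteq R'$ with ${\sf conf}_{R'}(Y')>0$. Then there exists $\bar{Y'} \subseteq Y'$ such that ${\sf conf}_{R'}(\bar{Y'})>0$ and $|\bar{Y'}| \le 2^c$.
   Context: Treedepth ${\sf td}$ of a graph: minimum height (number of vertices on a longest root-to-leaf path) of a rooted forest whose closure (each vertex joined to all its ancestors) contains the graph as a subgraph. For a vertex set $A$ of $H$, $\alpha(A)$ denotes the maximum size of an independent set of the induced subgraph $H[A]$. For $Y'\subseteq R'$, ${\sf conf}_{R'}(Y') = \alpha(R')-\alpha(R'\setminus Y')$. -}

module Defs where

open import Data.Nat using (ℕ; zero; suc; _≤_; _⊔_; _∸_)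
open import Data.Bool using (Bool; true; false; _∧_; not; if_then_else_)
open import Data.Fin using (Fin)
open import Data.Fin.Subset using (Subset; _∈_; ∣_∣)
open import Data.Vec using ([]; _∷_; lookup)
open import Data.List using (List; [_]; map; _++_; foldr; allFin)
open import Data.Maybe using (Maybe; just; nothing)
open import Data.Product using (Σ; _×_)
open import Data.Sum using (_⊎_)
open import Relation.Binary.PropositionalEquality using (_≡_)

record Graph (n : ℕ) : Set where
  field
    adj    : Fin n → Fin n → Bool
    sym    : ∀ u v → adj u v ≡ adj v u
    irrefl : ∀ v → adj v v ≡ false
open Graph public

allSubsets : ∀ n → List (Subset n)
allSubsets zero    = [ [] ]
allSubsets (suc n) = map (false ∷_) (allSubsets n) ++ map (true ∷_) (allSubsets n)

allᵇ : ∀ {A : Set} → (A → Bool) → List A → Bool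
allᵇ p = foldr (λ x b → p x ∧ b) true

_⇒ᵇ_ : Bool → Bool → Bool
false ⇒ᵇ _ = true
true  ⇒ᵇ b = b

subsetᵇ : ∀ {n} → Subset n → Subset n → Bool
subsetᵇ {n} S A = allᵇ (λ i → lookup S i ⇒ᵇ lookup A i) (allFin n)

indepᵇ : ∀ {n} → Graph n → Subset n → Bool
indepᵇ {n} G S =
  allᵇ (λ u → allᵇ (λ v → not (lookup S u ∧ lookup S v ∧ adj G u v)) (allFin n)) (allFin n)

α : ∀ {n} → Graph n → Subset n → ℕ
α {n} G A =
  foldr _⊔_ 0
    (map (λ S → if subsetᵇ S A ∧ indepᵇ G S then ∣ S ∣ else 0) (allSubsets n))

conf : ∀ {n} → Graph n → Subset n → Subset n → ℕ
conf G R Y = α G R ∸ α G (R Data.Fin.Subset.─ Y)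

-- A rooted forest on Fin n: parent pointers, with depth = number of vertices
-- on the path from the root to the vertex (roots have depth 1).
record RootedForest (n : ℕ) : Set where
  field
    parent      : Fin n → Maybe (Fin n)
    depth       : Fin n → ℕ
    root-depth  : ∀ v → parent v ≡ nothing → depth v ≡ 1
    child-depth : ∀ v u → parent v ≡ just u → depth v ≡ suc (depth u)
open RootedForest public

data Ancestor {n} (F : RootedForest n) : Fin n → Fin n → Set where
  self : ∀ {u} → Ancestor F u u
  up   : ∀ {u v w} → parent F v ≡ just w → Ancestor F u w → Ancestor F u v

-- td(H) ≤ c : some rooted forest of height ≤ c has closure containing H
TdAtMost : ∀ {n} → Graph n → ℕ → Set
TdAtMost {n} G c =
  Σ (RootedForest n) λ F →
    (∀ v → depth F v ≤ c) ×
    (∀ u v → adj G u v ≡ true → Ancestor F u v ⊎ Ancestor F v u)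

data Reach {n} (G : Graph n) : Fin n → Fin n → Set where
  here : ∀ {u} → Reach G u u
  step : ∀ {u w v} → adj G u w ≡ true → Reach G w v → Reach G u v

IsComponent : ∀ {n} → Graph n → Subset n → Set
IsComponent {n} G R =
  Σ (Fin n) λ v → v ∈ R × (∀ u → (u ∈ R → Reach G v u) × (Reach G v u → u ∈ R))

module Submission where

-- Call Z a hitting set of A when deleting Z lowers the independence number:
-- α(A ∖ Z) < α(A), so that conf_{R′}(Y′) > 0 says that Y′ hits R′.  Let F be a
-- rooted forest whose closure contains H.  We show that inside a set A whose
-- vertices occupy at most c consecutive levels of F, every hitting set Y contains
-- a hitting set of size at most 2^c.  The theorem is the case A = R′.

open import Defs
open import Data.Nat
  using (ℕ; zero; suc; _+_; _≤_; _<_; _⊔_; _^_; z≤n; s≤s; _<?_)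
open import Data.Nat.Properties
  using ( ≤-refl; ≤-reflexive; ≤-trans; ≤-antisym; ≤-<-trans; <-≤-trans; <-irrefl; ≤-pred
        ; ≮⇒≥; <⇒≱; ≰⇒>; <⇒≢; +-suc; +-identityʳ; +-mono-≤; +-mono-<-≤; +-mono-≤-<
        ; m≤m+n; n≤0⇒n≡0; m≤n⇒m≤n⊔o; m≤n⇒m≤o⊔n; ⊔-sel; ⊔-lub; m^n>0; m<n⇒0<n∸m; m∸n≢0⇒n<m
        ; <⇒≤; +-monoˡ-≤; suc-injective; module ≤-Reasoning)
open import Data.Bool using (Bool; true; false; _∧_; not; if_then_else_)
import Data.Bool.Properties as Bool
open import Data.Fin using (Fin)
import Data.Fin.Properties as Fin
open import Data.Fin.Subset
  using (Subset; _∈_; _∉_; _⊆_; _∪_; _∩_; _─_; _-_; ⊥; ⁅_⁆; ∣_∣; Nonempty; outside; inside)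
open import Data.Fin.Subset.Properties
  using ( _∈?_; ⊆-refl; ⊆-trans; ⊆-reflexive; ⊥⊆; ∉⊥; ∣⊥∣≡0; ∣⁅x⁆∣≡1; x∈⁅x⁆; x∈⁅y⁆⇒x≡y
        ; p⊆q⇒∣p∣≤∣q∣; p∩q⊆p; p∩q⊆q; x∈p∩q⁺; x∈p∩q⁻; p⊆p∪q; q⊆p∪q; x∈p∪q⁺; x∈p∪q⁻
        ; p─q⊆p; x∈p∧x∉q⇒x∈p─q; p─q─r≡p─r─q; p─q─r≡p─q∪r; p∩q≢∅⇒∣p─q∣<∣p∣
        ; nonempty?; Empty-unique)
open import Data.Vec using ([]; _∷_; here; there; tabulate)
open import Data.Vec.Properties using ([]=⇒lookup; lookup⇒[]=; lookup∘tabulate)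
open import Data.List using (List; map; filter; allFin)
import Data.List as List
open import Data.List.Membership.Propositional using () renaming (_∈_ to _∈ₗ_)
open import Data.List.Membership.Propositional.Properties
  using (∈-map⁺; ∈-allFin; ∈-++⁺ˡ; ∈-++⁺ʳ; ∈-filter⁺; ∈-filter⁻)
open import Data.List.Properties using (foldr-preservesᵒ; foldr-preservesᵇ)
import Data.List.Relation.Unary.All as All
open import Data.List.Relation.Unary.All.Properties using (map⁺)
import Data.List.Relation.Unary.Any as Any
open import Data.List.Extrema.Nat using (argmin; argmin-all; f[argmin]≤f[xs])
open import Data.Maybe using (just; nothing)
open import Data.Maybe.Properties using (just-injective)
open import Data.Product using (∃; _×_; _,_; proj₁; proj₂)
open import Data.Sum using (_⊎_; inj₁; inj₂; [_,_]) renaming (map to map-⊎)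
open import Function using (_∘_)
open import Relation.Nullary using (Dec; yes; no; does; ¬_; contradiction)
open import Relation.Nullary.Decidable using (_⊎-dec_; toSum)
open import Relation.Unary using (Pred; Decidable)
open import Relation.Binary.PropositionalEquality
  using (_≡_; _≢_; refl; trans; cong; cong₂; subst; subst₂; module ≡-Reasoning)
import Relation.Binary.PropositionalEquality as ≡

private variable n : ℕ

x∈p─q⇒x∉q : ∀ {x : Fin n} (p q : Subset n) → x ∈ p ─ q → x ∉ q
x∈p─q⇒x∉q (_ ∷ p) (outside ∷ q) here      ()
x∈p─q⇒x∉q (_ ∷ p) (_ ∷ q)       (there m) (there k) = x∈p─q⇒x∉q p q m k

─-mono : ∀ {A A′ Z Z′ : Subset n} → A ⊆ A′ → Z′ ⊆ Z → A ─ Z ⊆ A′ ─ Z′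
─-mono {A = A} {Z = Z} A⊆A′ Z′⊆Z x∈A─Z =
  x∈p∧x∉q⇒x∈p─q (A⊆A′ (p─q⊆p A Z x∈A─Z)) (x∈p─q⇒x∉q A Z x∈A─Z ∘ Z′⊆Z)

─-swap : ∀ {Z Z′ : Subset n} (A W : Subset n) → Z ⊆ Z′ → (A ─ Z′) ─ W ⊆ (A ─ W) ─ Z
─-swap {Z = Z} {Z′} A W Z⊆Z′ =
  ⊆-trans (⊆-reflexive (p─q─r≡p─r─q A Z′ W)) (─-mono ⊆-refl Z⊆Z′)

∣p∪q∣+∣p∩q∣≡∣p∣+∣q∣ : ∀ (p q : Subset n) → ∣ p ∪ q ∣ + ∣ p ∩ q ∣ ≡ ∣ p ∣ + ∣ q ∣
∣p∪q∣+∣p∩q∣≡∣p∣+∣q∣ []            []            = refl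
∣p∪q∣+∣p∩q∣≡∣p∣+∣q∣ (outside ∷ p) (outside ∷ q) = ∣p∪q∣+∣p∩q∣≡∣p∣+∣q∣ p q
∣p∪q∣+∣p∩q∣≡∣p∣+∣q∣ (inside  ∷ p) (outside ∷ q) = cong suc (∣p∪q∣+∣p∩q∣≡∣p∣+∣q∣ p q)
∣p∪q∣+∣p∩q∣≡∣p∣+∣q∣ (outside ∷ p) (inside  ∷ q) = begin
  suc (∣ p ∪ q ∣ + ∣ p ∩ q ∣) ≡⟨ cong suc (∣p∪q∣+∣p∩q∣≡∣p∣+∣q∣ p q) ⟩
  suc (∣ p ∣ + ∣ q ∣)         ≡⟨ +-suc ∣ p ∣ ∣ q ∣ ⟨
  ∣ p ∣ + suc ∣ q ∣           ∎
  where open ≡-Reasoning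
∣p∪q∣+∣p∩q∣≡∣p∣+∣q∣ (inside  ∷ p) (inside  ∷ q) = begin
  suc (∣ p ∪ q ∣ + suc ∣ p ∩ q ∣) ≡⟨ cong suc (+-suc ∣ p ∪ q ∣ ∣ p ∩ q ∣) ⟩
  suc (suc (∣ p ∪ q ∣ + ∣ p ∩ q ∣)) ≡⟨ cong (suc ∘ suc) (∣p∪q∣+∣p∩q∣≡∣p∣+∣q∣ p q) ⟩
  suc (suc (∣ p ∣ + ∣ q ∣))       ≡⟨ cong suc (+-suc ∣ p ∣ ∣ q ∣) ⟨
  suc (∣ p ∣ + suc ∣ q ∣)         ∎
  where open ≡-Reasoning

∣p∪q∣≤∣p∣+∣q∣ : ∀ (p q : Subset n) → ∣ p ∪ q ∣ ≤ ∣ p ∣ + ∣ q ∣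
∣p∪q∣≤∣p∣+∣q∣ p q = subst (∣ p ∪ q ∣ ≤_) (∣p∪q∣+∣p∩q∣≡∣p∣+∣q∣ p q) (m≤m+n _ _)

Disjoint : Subset n → Subset n → Set
Disjoint p q = ∀ {x} → x ∈ p → x ∉ q

∣p∪q∣≡∣p∣+∣q∣ : ∀ (p q : Subset n) → Disjoint p q → ∣ p ∪ q ∣ ≡ ∣ p ∣ + ∣ q ∣
∣p∪q∣≡∣p∣+∣q∣ {n} p q disjoint = begin
  ∣ p ∪ q ∣             ≡⟨ +-identityʳ _ ⟨
  ∣ p ∪ q ∣ + 0         ≡⟨ cong (∣ p ∪ q ∣ +_) ∣p∩q∣≡0 ⟨
  ∣ p ∪ q ∣ + ∣ p ∩ q ∣ ≡⟨ ∣p∪q∣+∣p∩q∣≡∣p∣+∣q∣ p q ⟩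
  ∣ p ∣ + ∣ q ∣         ∎
  where
  open ≡-Reasoning
  p∩q⊆⊥ : p ∩ q ⊆ ⊥
  p∩q⊆⊥ x∈p∩q = let x∈p , x∈q = x∈p∩q⁻ p q x∈p∩q in contradiction x∈q (disjoint x∈p)
  ∣p∩q∣≡0 : ∣ p ∩ q ∣ ≡ 0
  ∣p∩q∣≡0 = n≤0⇒n≡0 (subst (∣ p ∩ q ∣ ≤_) (∣⊥∣≡0 n) (p⊆q⇒∣p∣≤∣q∣ p∩q⊆⊥))

⁅x⁆⊆p : ∀ {x : Fin n} {p} → x ∈ p → ⁅ x ⁆ ⊆ p
⁅x⁆⊆p {x = x} x∈p y∈⁅x⁆ = subst (_∈ _) (≡.sym (x∈⁅y⁆⇒x≡y x y∈⁅x⁆)) x∈p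

∪-least : ∀ {p q r : Subset n} → p ⊆ r → q ⊆ r → p ∪ q ⊆ r
∪-least {p = p} {q} p⊆r q⊆r x∈p∪q = [ p⊆r , q⊆r ] (x∈p∪q⁻ p q x∈p∪q)

nonempty⇒∣p∣≥1 : ∀ {p : Subset n} → Nonempty p → 1 ≤ ∣ p ∣
nonempty⇒∣p∣≥1 (x , x∈p) = subst (_≤ _) (∣⁅x⁆∣≡1 x) (p⊆q⇒∣p∣≤∣q∣ (⁅x⁆⊆p x∈p))

select : ∀ {ℓ} {P : Pred (Fin n) ℓ} → Decidable P → Subset n
select P? = tabulate (does ∘ P?)

∈-select⁺ : ∀ {ℓ} {P : Pred (Fin n) ℓ} (P? : Decidable P) {x} → P x → x ∈ select P?
∈-select⁺ P? {x} px with P? x in eq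
... | yes _   = lookup⇒[]= x _ (trans (lookup∘tabulate (does ∘ P?) x) (cong does eq))
... | no ¬px = contradiction px ¬px

∈-select⁻ : ∀ {ℓ} {P : Pred (Fin n) ℓ} (P? : Decidable P) {x} → x ∈ select P? → P x
∈-select⁻ P? {x} x∈ with P? x in eq
... | yes px = px
... | no _   = contradiction (trans (≡.sym (cong does eq)) does≡true) λ ()
  where
  does≡true : does (P? x) ≡ true
  does≡true = trans (≡.sym (lookup∘tabulate (does ∘ P?) x)) ([]=⇒lookup x∈)

minimal-element : ∀ (f : Fin n → ℕ) {A : Subset n} → Nonempty A →
                  ∃ λ ρ → ρ ∈ A × (∀ {v} → v ∈ A → f ρ ≤ f v)
minimal-element {n} f {A} (x , x∈A) =
  argmin f x members ,
  argmin-all f {xs = members} x∈A (All.tabulate (proj₂ ∘ ∈-filter⁻ (_∈? A) {xs = allFin n})) ,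
  λ v∈A → All.lookup (f[argmin]≤f[xs] {f = f} x members) (∈-filter⁺ (_∈? A) (∈-allFin _) v∈A)
  where
  members : List (Fin n)
  members = filter (_∈? A) (allFin n)

+-<-split : ∀ {x y p q} → x + y < p + q → x < p ⊎ y < q
+-<-split {x} {y} {p} {q} x+y<p+q with x <? p
... | yes x<p = inj₁ x<p
... | no  x≮p = inj₂ (≰⇒> λ q≤y → <⇒≱ x+y<p+q (+-mono-≤ (≮⇒≥ x≮p) q≤y))

2^[1+c]≡2^c+2^c : ∀ c → 2 ^ suc c ≡ 2 ^ c + 2 ^ c
2^[1+c]≡2^c+2^c c = cong (2 ^ c +_) (+-identityʳ (2 ^ c))

∧-true : ∀ {a b} → a ∧ b ≡ true → a ≡ true × b ≡ true
∧-true {true} b≡true = refl , b≡true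

allᵇ⁺ : ∀ {A : Set} (p : A → Bool) xs → (∀ x → p x ≡ true) → allᵇ p xs ≡ true
allᵇ⁺ p List.[]       _ = refl
allᵇ⁺ p (x List.∷ xs) h rewrite h x = allᵇ⁺ p xs h

allᵇ⁻ : ∀ {A : Set} (p : A → Bool) xs → allᵇ p xs ≡ true → ∀ {x} → x ∈ₗ xs → p x ≡ true
allᵇ⁻ p (y List.∷ xs) h (Any.here refl)  = proj₁ (∧-true {p y} h)
allᵇ⁻ p (y List.∷ xs) h (Any.there x∈xs) = allᵇ⁻ p xs (proj₂ (∧-true {p y} h)) x∈xs

⇒ᵇ-true⁺ : ∀ {a b} → (a ≡ true → b ≡ true) → (a ⇒ᵇ b) ≡ true
⇒ᵇ-true⁺ {false} _ = refl
⇒ᵇ-true⁺ {true}  h = h refl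

⇒ᵇ-true⁻ : ∀ {a b} → (a ⇒ᵇ b) ≡ true → a ≡ true → b ≡ true
⇒ᵇ-true⁻ {true} h refl = h

nand-true⁺ : ∀ {a b c} → (a ≡ true → b ≡ true → c ≡ false) → not (a ∧ b ∧ c) ≡ true
nand-true⁺ {false}         _ = refl
nand-true⁺ {true} {false}  _ = refl
nand-true⁺ {true} {true}   h rewrite h refl refl = refl

nand-true⁻ : ∀ {a b c} → not (a ∧ b ∧ c) ≡ true → a ≡ true → b ≡ true → c ≡ false
nand-true⁻ {true} {true} {false} _ refl refl = refl

subsetᵇ⁺ : ∀ {S A : Subset n} → S ⊆ A → subsetᵇ S A ≡ true
subsetᵇ⁺ {S = S} {A} S⊆A =
  allᵇ⁺ _ (allFin _) λ i → ⇒ᵇ-true⁺ λ i∈S → []=⇒lookup (S⊆A (lookup⇒[]= i S i∈S))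

subsetᵇ⁻ : ∀ {S A : Subset n} → subsetᵇ S A ≡ true → S ⊆ A
subsetᵇ⁻ {S = S} {A} h {i} i∈S =
  lookup⇒[]= i A (⇒ᵇ-true⁻ (allᵇ⁻ _ (allFin _) h (∈-allFin i)) ([]=⇒lookup i∈S))

allSubsets-complete : ∀ {m} (S : Subset m) → S ∈ₗ allSubsets m
allSubsets-complete []            = Any.here refl
allSubsets-complete {suc m} (outside ∷ S) =
  ∈-++⁺ˡ (∈-map⁺ (outside ∷_) (allSubsets-complete S))
allSubsets-complete {suc m} (inside ∷ S) =
  ∈-++⁺ʳ (map (outside ∷_) (allSubsets m)) (∈-map⁺ (inside ∷_) (allSubsets-complete S))

module _ {n : ℕ} (H : Graph n) where

  Separated : Subset n → Subset n → Set
  Separated B C = ∀ {u v} → u ∈ B → v ∈ C → adj H u v ≡ false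

  Independent : Subset n → Set
  Independent S = Separated S S

  independent-⊆ : ∀ {S T} → S ⊆ T → Independent T → Independent S
  independent-⊆ S⊆T ind u∈S v∈S = ind (S⊆T u∈S) (S⊆T v∈S)

  independent-∪ : ∀ {S T} → Independent S → Independent T → Separated S T →
                  Independent (S ∪ T)
  independent-∪ {S} {T} indS indT sep {u} {v} u∈ v∈ with x∈p∪q⁻ S T u∈ | x∈p∪q⁻ S T v∈
  ... | inj₁ u∈S | inj₁ v∈S = indS u∈S v∈S
  ... | inj₁ u∈S | inj₂ v∈T = sep u∈S v∈T
  ... | inj₂ u∈T | inj₁ v∈S = trans (Graph.sym H u v) (sep v∈S u∈T)
  ... | inj₂ u∈T | inj₂ v∈T = indT u∈T v∈T

  indepᵇ⁺ : ∀ {S} → Independent S → indepᵇ H S ≡ true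
  indepᵇ⁺ {S} ind = allᵇ⁺ _ (allFin n) λ u → allᵇ⁺ _ (allFin n) λ v →
    nand-true⁺ λ u∈S v∈S → ind (lookup⇒[]= u S u∈S) (lookup⇒[]= v S v∈S)

  indepᵇ⁻ : ∀ {S} → indepᵇ H S ≡ true → Independent S
  indepᵇ⁻ {S} h {u} {v} u∈S v∈S =
    nand-true⁻ (allᵇ⁻ _ (allFin n) (allᵇ⁻ _ (allFin n) h (∈-allFin u)) (∈-allFin v))
               ([]=⇒lookup u∈S) ([]=⇒lookup v∈S)

  candidate : Subset n → Subset n → ℕ
  candidate A S = if subsetᵇ S A ∧ indepᵇ H S then ∣ S ∣ else 0

  Attained : Subset n → ℕ → Set
  Attained A m = ∃ λ S → S ⊆ A × Independent S × ∣ S ∣ ≡ m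

  α-maximal : ∀ {A S} → S ⊆ A → Independent S → ∣ S ∣ ≤ α H A
  α-maximal {A} {S} S⊆A ind = foldr-preservesᵒ ⊔-keeps-lower 0 _
    (inj₂ (Any.map (λ c≡x → subst (∣ S ∣ ≤_) c≡x (≤-reflexive (≡.sym candidate≡∣S∣)))
                   (∈-map⁺ (candidate A) (allSubsets-complete S))))
    where
    candidate≡∣S∣ : candidate A S ≡ ∣ S ∣
    candidate≡∣S∣ rewrite subsetᵇ⁺ S⊆A | indepᵇ⁺ ind = refl
    ⊔-keeps-lower : ∀ x y → ∣ S ∣ ≤ x ⊎ ∣ S ∣ ≤ y → ∣ S ∣ ≤ x ⊔ y
    ⊔-keeps-lower x y = [ m≤n⇒m≤n⊔o y , m≤n⇒m≤o⊔n x ]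

  α-attained : ∀ A → Attained A (α H A)
  α-attained A = foldr-preservesᵇ {P = Attained A} ⊔-keeps empty
                   (map⁺ (All.universal candidate-attained (allSubsets n)))
    where
    empty : Attained A 0
    empty = ⊥ , ⊥⊆ , (λ u∈⊥ _ → contradiction u∈⊥ ∉⊥) , ∣⊥∣≡0 n
    ⊔-keeps : ∀ {x y} → Attained A x → Attained A y → Attained A (x ⊔ y)
    ⊔-keeps {x} {y} ax ay with ⊔-sel x y
    ... | inj₁ x⊔y≡x = subst (Attained A) (≡.sym x⊔y≡x) ax
    ... | inj₂ x⊔y≡y = subst (Attained A) (≡.sym x⊔y≡y) ay
    candidate-attained : ∀ S → Attained A (candidate A S)
    candidate-attained S with subsetᵇ S A in S⊆A | indepᵇ H S in indS
    ... | true  | true  = S , subsetᵇ⁻ S⊆A , indepᵇ⁻ indS , refl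
    ... | true  | false = empty
    ... | false | _     = empty

  α-upper : ∀ {X m} → (∀ {S} → S ⊆ X → Independent S → ∣ S ∣ ≤ m) → α H X ≤ m
  α-upper {X} bound =
    let S , S⊆X , indS , ∣S∣≡α = α-attained X in subst (_≤ _) ∣S∣≡α (bound S⊆X indS)

  α-mono : ∀ {A B} → A ⊆ B → α H A ≤ α H B
  α-mono A⊆B = α-upper λ S⊆A indS → α-maximal (⊆-trans S⊆A A⊆B) indS

  α≤∣A∣ : ∀ {A} → α H A ≤ ∣ A ∣
  α≤∣A∣ {A} = α-upper {A} λ S⊆A _ → p⊆q⇒∣p∣≤∣q∣ S⊆A

  α-cover : ∀ {X B C} → X ⊆ B ∪ C → α H X ≤ α H B + α H C
  α-cover {X} {B} {C} X⊆B∪C = α-upper λ {S} S⊆X indS →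
    let part : ∀ D → ∣ S ∩ D ∣ ≤ α H D
        part D = α-maximal (p∩q⊆q S D) (independent-⊆ (p∩q⊆p S D) indS)
        S⊆S∩B∪S∩C : S ⊆ (S ∩ B) ∪ (S ∩ C)
        S⊆S∩B∪S∩C x∈S = x∈p∪q⁺ (map-⊎ (λ x∈B → x∈p∩q⁺ (x∈S , x∈B)) (λ x∈C → x∈p∩q⁺ (x∈S , x∈C))
                                             (x∈p∪q⁻ B C (X⊆B∪C (S⊆X x∈S))))
    in begin
      ∣ S ∣                   ≤⟨ p⊆q⇒∣p∣≤∣q∣ S⊆S∩B∪S∩C ⟩
      ∣ (S ∩ B) ∪ (S ∩ C) ∣   ≤⟨ ∣p∪q∣≤∣p∣+∣q∣ (S ∩ B) (S ∩ C) ⟩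
      ∣ S ∩ B ∣ + ∣ S ∩ C ∣   ≤⟨ +-mono-≤ (part B) (part C) ⟩
      α H B + α H C           ∎
    where open ≤-Reasoning

  α-separated : ∀ {X B C} → B ⊆ X → C ⊆ X → Disjoint B C → Separated B C →
                α H B + α H C ≤ α H X
  α-separated {X} {B} {C} B⊆X C⊆X disjoint separated =
    let T , T⊆B , indT , ∣T∣≡αB = α-attained B
        R , R⊆C , indR , ∣R∣≡αC = α-attained C
        indT∪R : Independent (T ∪ R)
        indT∪R = independent-∪ indT indR λ u∈T v∈R → separated (T⊆B u∈T) (R⊆C v∈R)
    in begin
      α H B + α H C   ≡⟨ cong₂ _+_ ∣T∣≡αB ∣R∣≡αC ⟨
      ∣ T ∣ + ∣ R ∣   ≡⟨ ∣p∪q∣≡∣p∣+∣q∣ T R (λ x∈T x∈R → disjoint (T⊆B x∈T) (R⊆C x∈R)) ⟨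
      ∣ T ∪ R ∣       ≤⟨ α-maximal (∪-least (⊆-trans T⊆B B⊆X) (⊆-trans R⊆C C⊆X)) indT∪R ⟩
      α H X           ∎
    where open ≤-Reasoning

  record Splits (A B C : Subset n) : Set where
    field
      cover     : A ⊆ B ∪ C
      left⊆     : B ⊆ A
      right⊆    : C ⊆ A
      disjoint  : Disjoint B C
      separated : Separated B C

  α-split : ∀ {A B C} → Splits A B C → α H A ≡ α H B + α H C
  α-split s = ≤-antisym (α-cover cover) (α-separated left⊆ right⊆ disjoint separated)
    where open Splits s

  splits-─ : ∀ {A B C} → Splits A B C → ∀ Z → Splits (A ─ Z) (B ─ Z) (C ─ Z)
  splits-─ {A} {B} {C} s Z = record
    { cover     = λ x∈A─Z →
        let x∉Z = x∈p─q⇒x∉q A Z x∈A─Z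
        in x∈p∪q⁺ (map-⊎ (λ x∈B → x∈p∧x∉q⇒x∈p─q x∈B x∉Z) (λ x∈C → x∈p∧x∉q⇒x∈p─q x∈C x∉Z)
                                (x∈p∪q⁻ B C (cover (p─q⊆p A Z x∈A─Z))))
    ; left⊆     = ─-mono left⊆ ⊆-refl
    ; right⊆    = ─-mono right⊆ ⊆-refl
    ; disjoint  = λ x∈B─Z → disjoint (p─q⊆p B Z x∈B─Z) ∘ p─q⊆p C Z
    ; separated = λ u∈B─Z v∈C─Z → separated (p─q⊆p B Z u∈B─Z) (p─q⊆p C Z v∈C─Z)
    }
    where open Splits s

  Hits : Subset n → Subset n → Set
  Hits A Z = α H (A ─ Z) < α H A

  hits-nonempty : ∀ {A Z} → Hits A Z → Nonempty A
  hits-nonempty {A} hit with nonempty? A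
  ... | yes nonempty = nonempty
  ... | no  empty    = contradiction (<-≤-trans hit αA≤0) λ ()
    where
    αA≤0 : α H A ≤ 0
    αA≤0 = subst (α H A ≤_) (trans (cong ∣_∣ (Empty-unique empty)) (∣⊥∣≡0 n)) (α≤∣A∣ {A})

  hits-split⁻ : ∀ {A B C Z} → Splits A B C → Hits A Z → Hits B Z ⊎ Hits C Z
  hits-split⁻ {A} {B} {C} {Z} s hit =
    +-<-split (subst₂ _<_ (α-split (splits-─ s Z)) (α-split s) hit)

  hits-splitˡ : ∀ {A B C Z} → Splits A B C → Hits B Z → Hits A Z
  hits-splitˡ {A} {B} {C} {Z} s hit rewrite α-split (splits-─ s Z) | α-split s =
    +-mono-<-≤ hit (α-mono (p─q⊆p C Z))

  hits-splitʳ : ∀ {A B C Z} → Splits A B C → Hits C Z → Hits A Z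
  hits-splitʳ {A} {B} {C} {Z} s hit rewrite α-split (splits-─ s Z) | α-split s =
    +-mono-≤-< (α-mono (p─q⊆p B Z)) hit

  InClosedNbhd : Fin n → Pred (Fin n) _
  InClosedNbhd ρ v = v ≡ ρ ⊎ adj H ρ v ≡ true

  inClosedNbhd? : ∀ ρ → Decidable (InClosedNbhd ρ)
  inClosedNbhd? ρ v = v Fin.≟ ρ ⊎-dec adj H ρ v Bool.≟ true

  closedNbhd : Fin n → Subset n
  closedNbhd ρ = select (inClosedNbhd? ρ)

  ρ∈N[ρ] : ∀ ρ → ρ ∈ closedNbhd ρ
  ρ∈N[ρ] ρ = ∈-select⁺ (inClosedNbhd? ρ) (inj₁ refl)

  ∉N[ρ]⇒nonadjacent : ∀ {ρ v} → v ∉ closedNbhd ρ → adj H ρ v ≡ false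
  ∉N[ρ]⇒nonadjacent {ρ} v∉N[ρ] = Bool.¬-not (v∉N[ρ] ∘ ∈-select⁺ (inClosedNbhd? ρ) ∘ inj₂)

  independent-∉N[ρ] : ∀ {S ρ x} → Independent S → ρ ∈ S → x ∈ S → x ≢ ρ → x ∉ closedNbhd ρ
  independent-∉N[ρ] {ρ = ρ} indS ρ∈S x∈S x≢ρ x∈N[ρ] =
    [ x≢ρ , (λ adjacent → contradiction (trans (≡.sym adjacent) (indS ρ∈S x∈S)) λ ()) ]
    (∈-select⁻ (inClosedNbhd? ρ) x∈N[ρ])

  -- The root recurrence, upper half: an independent subset of X either
  -- avoids ρ, or consists of ρ and vertices of X outside N[ρ].
  α-root-≤ : ∀ X ρ → α H X ≤ α H (X - ρ) ⊔ suc (α H (X ─ closedNbhd ρ))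
  α-root-≤ X ρ = α-upper λ S⊆X indS → bound S⊆X indS (ρ ∈? _)
    where
    N = closedNbhd ρ
    bound : ∀ {S} → S ⊆ X → Independent S → Dec (ρ ∈ S) →
            ∣ S ∣ ≤ α H (X - ρ) ⊔ suc (α H (X ─ N))
    bound {S} S⊆X indS (no ρ∉S) = m≤n⇒m≤n⊔o _ (α-maximal S⊆X-ρ indS)
      where
      S⊆X-ρ : S ⊆ X - ρ
      S⊆X-ρ x∈S =
        x∈p∧x∉q⇒x∈p─q (S⊆X x∈S) λ x∈⁅ρ⁆ → ρ∉S (subst (_∈ S) (x∈⁅y⁆⇒x≡y ρ x∈⁅ρ⁆) x∈S)
    bound {S} S⊆X indS (yes ρ∈S) = m≤n⇒m≤o⊔n _ (begin
      ∣ S ∣                 ≤⟨ p⊆q⇒∣p∣≤∣q∣ S⊆ρ∪[S─N] ⟩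
      ∣ ⁅ ρ ⁆ ∪ (S ─ N) ∣   ≤⟨ ∣p∪q∣≤∣p∣+∣q∣ ⁅ ρ ⁆ (S ─ N) ⟩
      ∣ ⁅ ρ ⁆ ∣ + ∣ S ─ N ∣ ≡⟨ cong (_+ ∣ S ─ N ∣) (∣⁅x⁆∣≡1 ρ) ⟩
      suc ∣ S ─ N ∣         ≤⟨ s≤s (α-maximal (─-mono S⊆X ⊆-refl) (independent-⊆ (p─q⊆p S N) indS)) ⟩
      suc (α H (X ─ N))     ∎)
      where
      open ≤-Reasoning
      S⊆ρ∪[S─N] : S ⊆ ⁅ ρ ⁆ ∪ (S ─ N)
      S⊆ρ∪[S─N] {x} x∈S with x Fin.≟ ρ
      ... | yes refl = x∈p∪q⁺ (inj₁ (x∈⁅x⁆ x))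
      ... | no  x≢ρ  = x∈p∪q⁺ (inj₂ (x∈p∧x∉q⇒x∈p─q x∈S (independent-∉N[ρ] indS ρ∈S x∈S x≢ρ)))

  -- The root recurrence, lower half: ρ together with an independent subset of
  -- X ∖ N[ρ] is independent.
  α-root-≥ : ∀ {X ρ} → ρ ∈ X → suc (α H (X ─ closedNbhd ρ)) ≤ α H X
  α-root-≥ {X} {ρ} ρ∈X =
    ≤-trans (+-mono-≤ 1≤α⁅ρ⁆ ≤-refl) (α-separated (⁅x⁆⊆p ρ∈X) (p─q⊆p X N) disjoint separated)
    where
    N = closedNbhd ρ
    1≤α⁅ρ⁆ : 1 ≤ α H ⁅ ρ ⁆
    1≤α⁅ρ⁆ = subst (_≤ α H ⁅ ρ ⁆) (∣⁅x⁆∣≡1 ρ) (α-maximal ⊆-refl singleton)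
      where
      singleton : Independent ⁅ ρ ⁆
      singleton u∈ v∈ with x∈⁅y⁆⇒x≡y ρ u∈ | x∈⁅y⁆⇒x≡y ρ v∈
      ... | refl | refl = Graph.irrefl H ρ
    disjoint : Disjoint ⁅ ρ ⁆ (X ─ N)
    disjoint x∈⁅ρ⁆ x∈X─N with x∈⁅y⁆⇒x≡y ρ x∈⁅ρ⁆
    ... | refl = x∈p─q⇒x∉q X N x∈X─N (ρ∈N[ρ] ρ)
    separated : Separated ⁅ ρ ⁆ (X ─ N)
    separated u∈⁅ρ⁆ v∈X─N with x∈⁅y⁆⇒x≡y ρ u∈⁅ρ⁆
    ... | refl = ∉N[ρ]⇒nonadjacent (x∈p─q⇒x∉q X N v∈X─N)

  Shrinkable : ℕ → Subset n → Subset n → Set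
  Shrinkable c A Y = ∃ λ Ȳ → Ȳ ⊆ Y × Hits A Ȳ × ∣ Ȳ ∣ ≤ 2 ^ c

  shrinkable-splitˡ : ∀ {c A B C Y} → Splits A B C → Shrinkable c B Y → Shrinkable c A Y
  shrinkable-splitˡ s (Ȳ , Ȳ⊆Y , hit , size) = Ȳ , Ȳ⊆Y , hits-splitˡ s hit , size

  shrinkable-splitʳ : ∀ {c A B C Y} → Splits A B C → Shrinkable c C Y → Shrinkable c A Y
  shrinkable-splitʳ s (Ȳ , Ȳ⊆Y , hit , size) = Ȳ , Ȳ⊆Y , hits-splitʳ s hit , size

  -- Fix ρ ∈ X and a hitting set Y of X.  A large independent
  -- subset of X either avoids ρ or passes through ρ; we find a part Z₀ ⊆ Y
  -- destroying those of the first kind inside X - ρ and a part Z₁ ⊆ Y destroying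
  -- those of the second kind inside X ∖ N[ρ], each with at most 2^c vertices.
  module _ {c : ℕ} {X : Subset n} {ρ : Fin n} (ρ∈X : ρ ∈ X) where

    private
      N  = closedNbhd ρ
      X⁻ = X - ρ
      X° = X ─ N

      ∣⊥∣≤2^c : ∣ ⊥ {n} ∣ ≤ 2 ^ c
      ∣⊥∣≤2^c = subst (_≤ 2 ^ c) (≡.sym (∣⊥∣≡0 n)) z≤n

    -- After deleting Z, independent subsets of X avoiding ρ are smaller than α X.
    Avoiding : Subset n → Set
    Avoiding Z = α H (X⁻ ─ Z) < α H X

    -- After deleting Z, independent subsets of X through ρ are smaller than α X.
    Through : Subset n → Set
    Through Z = ρ ∈ Z ⊎ suc (α H (X° ─ Z)) < α H X

    avoiding : ∀ {Y} → Hits X Y → (Hits X⁻ Y → Shrinkable c X⁻ Y) →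
               ∃ λ Z → Z ⊆ Y × ∣ Z ∣ ≤ 2 ^ c × Avoiding Z
    avoiding {Y} hit shrink-avoiding with α H X⁻ <? α H X
    ... | yes αX⁻<αX = ⊥ , ⊥⊆ , ∣⊥∣≤2^c , ≤-<-trans (α-mono (p─q⊆p X⁻ ⊥)) αX⁻<αX
    ... | no  αX⁻≮αX =
      let Z , Z⊆Y , Z-hits , size = shrink-avoiding hits-X⁻
      in Z , Z⊆Y , size , <-≤-trans Z-hits (α-mono (p─q⊆p X ⁅ ρ ⁆))
      where
      hits-X⁻ : Hits X⁻ Y
      hits-X⁻ =
        <-≤-trans (≤-<-trans (α-mono (─-mono {Z = Y} (p─q⊆p X ⁅ ρ ⁆) ⊆-refl)) hit) (≮⇒≥ αX⁻≮αX)

    through : ∀ {Y} → Hits X Y → (Hits X° Y → Shrinkable c X° Y) →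
              ∃ λ Z → Z ⊆ Y × ∣ Z ∣ ≤ 2 ^ c × Through Z
    through {Y} hit shrink-through with ρ ∈? Y
    ... | yes ρ∈Y =
      ⁅ ρ ⁆ , ⁅x⁆⊆p ρ∈Y , subst (_≤ 2 ^ c) (≡.sym (∣⁅x⁆∣≡1 ρ)) (m^n>0 2 c) , inj₁ (x∈⁅x⁆ ρ)
    ... | no  ρ∉Y with suc (α H X°) <? α H X
    ...   | yes 1+αX°<αX =
      ⊥ , ⊥⊆ , ∣⊥∣≤2^c , inj₂ (≤-<-trans (s≤s (α-mono (p─q⊆p X° ⊥))) 1+αX°<αX)
    ...   | no  1+αX°≮αX =
      let Z , Z⊆Y , Z-hits , size = shrink-through hits-X°
      in Z , Z⊆Y , size , inj₂ (<-≤-trans (s≤s Z-hits) (α-root-≥ ρ∈X))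
      where
      hits-X° : Hits X° Y
      hits-X° = ≤-pred (begin-strict
        suc (α H (X° ─ Y))        ≤⟨ s≤s (α-mono (─-swap X Y (⊆-refl {x = N}))) ⟩
        suc (α H ((X ─ Y) ─ N))   ≤⟨ α-root-≥ (x∈p∧x∉q⇒x∈p─q ρ∈X ρ∉Y) ⟩
        α H (X ─ Y)               <⟨ hit ⟩
        α H X                     ≤⟨ ≮⇒≥ 1+αX°≮αX ⟩
        suc (α H X°)              ∎)
        where open ≤-Reasoning

    combine : ∀ {Z₀ Z₁} → Avoiding Z₀ → Through Z₁ → Hits X (Z₀ ∪ Z₁)
    combine {Z₀} {Z₁} Z₀-avoiding (inj₁ ρ∈Z₁) = ≤-<-trans (α-mono X─Ȳ⊆X⁻─Z₀) Z₀-avoiding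
      where
      X─Ȳ⊆X⁻─Z₀ : X ─ (Z₀ ∪ Z₁) ⊆ X⁻ ─ Z₀
      X─Ȳ⊆X⁻─Z₀ =
        ⊆-trans (─-mono ⊆-refl (∪-least (⁅x⁆⊆p (q⊆p∪q Z₀ Z₁ ρ∈Z₁)) (p⊆p∪q {p = Z₀} Z₁)))
                (⊆-reflexive (≡.sym (p─q─r≡p─q∪r X ⁅ ρ ⁆ Z₀)))
    combine {Z₀} {Z₁} Z₀-avoiding (inj₂ Z₁-through) = begin-strict
      α H (X ─ Ȳ)                                    ≤⟨ α-root-≤ (X ─ Ȳ) ρ ⟩
      α H ((X ─ Ȳ) - ρ) ⊔ suc (α H ((X ─ Ȳ) ─ N))   <⟨ ⊔-lub avoid-part through-part ⟩
      α H X                                          ∎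
      where
      open ≤-Reasoning
      Ȳ = Z₀ ∪ Z₁
      avoid-part : α H ((X ─ Ȳ) - ρ) < α H X
      avoid-part = ≤-<-trans (α-mono (─-swap X ⁅ ρ ⁆ (p⊆p∪q {p = Z₀} Z₁))) Z₀-avoiding
      through-part : suc (α H ((X ─ Ȳ) ─ N)) < α H X
      through-part = ≤-<-trans (s≤s (α-mono (─-swap X N (q⊆p∪q Z₀ Z₁)))) Z₁-through

    root-step : ∀ {Y} → Hits X Y →
                (Hits (X - ρ) Y → Shrinkable c (X - ρ) Y) →
                (Hits (X ─ closedNbhd ρ) Y → Shrinkable c (X ─ closedNbhd ρ) Y) →
                Shrinkable (suc c) X Y
    root-step hit shrink-avoiding shrink-through =
      let Z₀ , Z₀⊆Y , ∣Z₀∣≤2^c , Z₀-avoiding = avoiding hit shrink-avoiding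
          Z₁ , Z₁⊆Y , ∣Z₁∣≤2^c , Z₁-through  = through hit shrink-through
      in Z₀ ∪ Z₁ , ∪-least Z₀⊆Y Z₁⊆Y , combine Z₀-avoiding Z₁-through ,
         (begin
           ∣ Z₀ ∪ Z₁ ∣     ≤⟨ ∣p∪q∣≤∣p∣+∣q∣ Z₀ Z₁ ⟩
           ∣ Z₀ ∣ + ∣ Z₁ ∣ ≤⟨ +-mono-≤ ∣Z₀∣≤2^c ∣Z₁∣≤2^c ⟩
           2 ^ c + 2 ^ c   ≡⟨ 2^[1+c]≡2^c+2^c c ⟨
           2 ^ suc c       ∎)
      where open ≤-Reasoning

module _ {n : ℕ} (F : RootedForest n) where

  depth≥1 : ∀ v → 1 ≤ depth F v
  depth≥1 v with parent F v in eq
  ... | nothing = ≤-reflexive (≡.sym (root-depth F v eq))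
  ... | just u  = subst (1 ≤_) (≡.sym (child-depth F v u eq)) (s≤s z≤n)

  ancestor-trans : ∀ {u w v} → Ancestor F u w → Ancestor F w v → Ancestor F u v
  ancestor-trans u⇝w self          = u⇝w
  ancestor-trans u⇝w (up p w⇝v′) = up p (ancestor-trans u⇝w w⇝v′)

  ancestor-depth : ∀ {u v} → Ancestor F u v → u ≡ v ⊎ depth F u < depth F v
  ancestor-depth self = inj₁ refl
  ancestor-depth {u} {v} (up {w = w} p u⇝w) =
    inj₂ (subst (depth F u <_) (≡.sym (child-depth F v w p))
                (s≤s ([ ≤-reflexive ∘ cong (depth F) , <⇒≤ ] (ancestor-depth u⇝w))))

  ancestor-comparable : ∀ {u w v} → Ancestor F u v → Ancestor F w v →
                        Ancestor F u w ⊎ Ancestor F w u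
  ancestor-comparable self         w⇝v          = inj₂ w⇝v
  ancestor-comparable (up p u⇝v′) self         = inj₁ (up p u⇝v′)
  ancestor-comparable (up p u⇝v′) (up q w⇝v″) with trans (≡.sym p) q
  ... | refl = ancestor-comparable u⇝v′ w⇝v″

  -- Being an ancestor is decidable: walk up from v, at most depth v steps.
  ancestor? : ∀ u v → Dec (Ancestor F u v)
  ancestor? u v = search (depth F v) v refl
    where
    search : ∀ k v → depth F v ≡ k → Dec (Ancestor F u v)
    search k v d with u Fin.≟ v | parent F v in pv
    ... | yes refl | _       = yes self
    ... | no  u≢v  | nothing =
      no λ { self → u≢v refl ; (up p _) → contradiction (trans (≡.sym pv) p) λ () }
    search zero    v d | no _   | just w =
      contradiction (trans (≡.sym d) (child-depth F v w pv)) λ ()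
    search (suc k) v d | no u≢v | just w
      with search k w (suc-injective (trans (≡.sym (child-depth F v w pv)) d))
    ... | yes u⇝w = yes (up pv u⇝w)
    ... | no  u⇝̸w = no λ
      { self          → u≢v refl
      ; (up p u⇝w′) → u⇝̸w (subst (Ancestor F u) (just-injective (trans (≡.sym p) pv)) u⇝w′)
      }

  descendants : Fin n → Subset n
  descendants ρ = select (ancestor? ρ)

  ρ∈subtree : ∀ {A ρ} → ρ ∈ A → ρ ∈ A ∩ descendants ρ
  ρ∈subtree {ρ = ρ} ρ∈A = x∈p∩q⁺ (ρ∈A , ∈-select⁺ (ancestor? ρ) self)

  ClosureContains : Graph n → Set
  ClosureContains H = ∀ u v → adj H u v ≡ true → Ancestor F u v ⊎ Ancestor F v u

  -- Let ρ be a vertex of A of minimal depth.  No edge of H leaves the subtree of ρ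
  -- inside A, so A splits into the descendants of ρ and the rest.
  subtree-splits : ∀ {H A ρ} → ClosureContains H →
                   ρ ∈ A → (∀ {v} → v ∈ A → depth F ρ ≤ depth F v) →
                   Splits H A (A ∩ descendants ρ) (A ─ descendants ρ)
  subtree-splits {H} {A} {ρ} closure ρ∈A minimal = record
    { cover     = λ {x} x∈A →
        x∈p∪q⁺ (map-⊎ (λ x∈D → x∈p∩q⁺ (x∈A , x∈D)) (x∈p∧x∉q⇒x∈p─q x∈A) (toSum (x ∈? D)))
    ; left⊆     = p∩q⊆p A D
    ; right⊆    = p─q⊆p A D
    ; disjoint  = λ x∈A∩D x∈A─D → x∈p─q⇒x∉q A D x∈A─D (proj₂ (x∈p∩q⁻ A D x∈A∩D))
    ; separated = λ u∈A∩D w∈A─D → Bool.¬-not λ adjacent →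
        no-edge-out (∈-select⁻ (ancestor? ρ) (proj₂ (x∈p∩q⁻ A D u∈A∩D)))
                    (x∈p─q⇒x∉q A D w∈A─D ∘ ∈-select⁺ (ancestor? ρ)) (p─q⊆p A D w∈A─D) adjacent
    }
    where
    D = descendants ρ
    -- An edge from a descendant u of ρ to w ∈ A makes w a descendant of ρ:
    -- otherwise w is a proper ancestor of ρ, contradicting the minimality of ρ.
    no-edge-out : ∀ {u w} → Ancestor F ρ u → ¬ Ancestor F ρ w → w ∈ A → adj H u w ≢ true
    no-edge-out {u} {w} ρ⇝u ρ⇝̸w w∈A adjacent with closure u w adjacent
    ... | inj₁ u⇝w = ρ⇝̸w (ancestor-trans ρ⇝u u⇝w)
    ... | inj₂ w⇝u with ancestor-comparable ρ⇝u w⇝u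
    ...   | inj₁ ρ⇝w = ρ⇝̸w ρ⇝w
    ...   | inj₂ w⇝ρ with ancestor-depth w⇝ρ
    ...     | inj₁ refl = ρ⇝̸w self
    ...     | inj₂ deeper = <⇒≱ deeper (minimal w∈A)

  Layered : ℕ → ℕ → Subset n → Set
  Layered lo c A = ∀ {v} → v ∈ A → lo < depth F v × depth F v ≤ lo + c

  layered-⊆ : ∀ {lo c A B} → A ⊆ B → Layered lo c B → Layered lo c A
  layered-⊆ A⊆B layered = layered ∘ A⊆B

  layered-empty : ∀ {lo A} → Layered lo 0 A → ¬ Nonempty A
  layered-empty {lo} layered (v , v∈A) =
    let lo<d , d≤lo+0 = layered v∈A in <-irrefl (≡.sym (+-identityʳ lo)) (<-≤-trans lo<d d≤lo+0)

  layered-below : ∀ {lo c A ρ} → Layered lo (suc c) A → ρ ∈ A →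
                  Layered (depth F ρ) c ((A ∩ descendants ρ) - ρ)
  layered-below {lo} {c} {A} {ρ} layered ρ∈A {v} v∈ = deeper , upper
    where
    v∈A∩D = p─q⊆p (A ∩ descendants ρ) ⁅ ρ ⁆ v∈
    v∈A   = proj₁ (x∈p∩q⁻ A (descendants ρ) v∈A∩D)
    deeper : depth F ρ < depth F v
    deeper with ancestor-depth (∈-select⁻ (ancestor? ρ) (proj₂ (x∈p∩q⁻ A (descendants ρ) v∈A∩D)))
    ... | inj₁ refl = contradiction (x∈⁅x⁆ ρ) (x∈p─q⇒x∉q (A ∩ descendants ρ) ⁅ ρ ⁆ v∈)
    ... | inj₂ ρ-above = ρ-above
    upper : depth F v ≤ depth F ρ + c
    upper = begin
      depth F v     ≤⟨ proj₂ (layered v∈A) ⟩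
      lo + suc c    ≡⟨ +-suc lo c ⟩
      suc lo + c    ≤⟨ +-monoˡ-≤ c (proj₁ (layered ρ∈A)) ⟩
      depth F ρ + c ∎
      where open ≤-Reasoning

module _ {n : ℕ} (H : Graph n) (F : RootedForest n) (closure : ClosureContains F H) where

  -- Induction step: split A at a vertex ρ of minimal depth.  If Y hits the
  -- subtree of ρ, apply the root step there, whose two sets are layered one
  -- level deeper; otherwise Y hits the rest of A, which is smaller.
  shrink-step : ∀ {c lo A Y ρ} → Layered F lo (suc c) A → Hits H A Y →
                ρ ∈ A → (∀ {v} → v ∈ A → depth F ρ ≤ depth F v) →
                (∀ {B} → Layered F (depth F ρ) c B → Hits H B Y → Shrinkable H c B Y) →
                (Hits H (A ─ descendants F ρ) Y →
                 Shrinkable H (suc c) (A ─ descendants F ρ) Y) →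
                Shrinkable H (suc c) A Y
  shrink-step {c} {lo} {A} {Y} {ρ} layered hit ρ∈A minimal shrink-deeper shrink-rest =
    [ (λ hits-subtree → shrinkable-splitˡ H {suc c} split
         (root-step H {c} {B} (ρ∈subtree F ρ∈A) hits-subtree (shrink-deeper layered-B⁻)
                                              (shrink-deeper (layered-⊆ F B°⊆B⁻ layered-B⁻))))
    , (λ hits-rest → shrinkable-splitʳ H {suc c} split (shrink-rest hits-rest))
    ] (hits-split⁻ H split hit)
    where
    split = subtree-splits F closure ρ∈A minimal
    B = A ∩ descendants F ρ
    layered-B⁻ : Layered F (depth F ρ) c (B - ρ)
    layered-B⁻ = layered-below F layered ρ∈A
    B°⊆B⁻ : B ─ closedNbhd H ρ ⊆ B - ρ
    B°⊆B⁻ = ─-mono ⊆-refl (⁅x⁆⊆p (ρ∈N[ρ] H ρ))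

  shrink : ∀ c k lo {A} Y → ∣ A ∣ ≤ k → Layered F lo c A → Hits H A Y → Shrinkable H c A Y
  shrink zero    k       lo Y _     layered hit =
    contradiction (hits-nonempty H hit) (layered-empty F layered)
  shrink (suc c) zero    lo {A} Y ∣A∣≤0 _ hit =
    contradiction (≤-trans (nonempty⇒∣p∣≥1 (hits-nonempty H {A} hit)) ∣A∣≤0) λ ()
  shrink (suc c) (suc k) lo {A} Y ∣A∣≤1+k layered hit =
    let ρ , ρ∈A , minimal = minimal-element (depth F) (hits-nonempty H hit)
        D = descendants F ρ
        ∣A─D∣≤k = ≤-pred (≤-trans (p∩q≢∅⇒∣p─q∣<∣p∣ A D (ρ , ρ∈subtree F ρ∈A)) ∣A∣≤1+k)
    in shrink-step layered hit ρ∈A minimal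
         (shrink c _ (depth F ρ) Y ≤-refl)
         (shrink (suc c) k lo Y ∣A─D∣≤k (layered-⊆ F (p─q⊆p A D) layered))

-- The theorem: R′ lies in the levels (0, c] of the forest, and conf > 0 says
-- that Y′ hits R′.
lemma1 : ∀ {n} (c : ℕ) → 1 ≤ c → (H : Graph n) → TdAtMost H c →
         (R′ Y′ : Subset n) → IsComponent H R′ → Y′ ⊆ R′ → 0 < conf H R′ Y′ →
         ∃ λ Ȳ → Ȳ ⊆ Y′ × 0 < conf H R′ Ȳ × ∣ Ȳ ∣ ≤ 2 ^ c
lemma1 c _ H (F , height≤c , closure) R′ Y′ _ _ 0<conf =
  let Ȳ , Ȳ⊆Y′ , Ȳ-hits , ∣Ȳ∣≤2^c = shrink H F closure c ∣ R′ ∣ 0 Y′ ≤-refl layered Y′-hits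
  in Ȳ , Ȳ⊆Y′ , m<n⇒0<n∸m Ȳ-hits , ∣Ȳ∣≤2^c
  where
  layered : Layered F 0 c R′
  layered {v} _ = depth≥1 F v , height≤c v
  Y′-hits : Hits H R′ Y′
  Y′-hits = m∸n≢0⇒n<m (<⇒≢ 0<conf ∘ ≡.sym)
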